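{- Let $A$ be a finite alphabet, $X$ a set disjoint from $A$, and $(o,\delta):X\to\mathbb{B}\times\mathcal{P}_\omega((X+A)^*)^A$. Let $(O,\Delta)$ and $(\hat o,\hat\delta)$ be as defined below. Then $(O,\Delta)=(\hat o,\hat\delta)$, i.e. for every $S\in\mathcal{P}_\omega((X+A)^*)$, $O(S)=\hat o(S)$ and $\Delta(S)=\hat\delta(S)$.
   Context: $i(1)=\{\epsilon\}$, $i(0)=\emptyset$; write $x_a=\delta(x)(a)$ and $S_a=\hat\delta(S)(a)$. The $\mathbb{B}\times(-)^A$-coalgebra $(\hat o,\hat\delta)$ on $\mathcal{P}_\omega((X+A)^*)$ is defined inductively: $\hat o(\{\epsilon\})=1$, $\{\epsilon\}_a=\emptyset$; for $x\in X$, $s\in(X+A)^*$: $\hat o(\{xs\})=o(x)\wedge\hat o(\{s\})$, $\{xs\}_a=x_a\cdot\big(i(\hat o(\{s\}))\cup\bigcup_{b\in A}\{b\}\{s\}_b\big)\cup i(o(x))\{s\}_a$; for $b\in A$: $\hat o(\{bs\})=0$, $\{bs\}_a=i([b=a])\cdot\big(i(\hat o(\{s\}))\cup\bigcup_{c\in A}\{c\}\{s\}_c\big)$, where $[b=a]=1$ if $b=a$ and $0$ otherwise; for finite $S$: $\hat o(S)=\bigvee_{s\in S}\hat o(\{s\})$, $S_a=\bigcup_{s\in S}\{s\}_a$. On $\mathbb{B}\times\mathcal{P}_\omega((X+A)^*)^A$ define $\mathtt{0}=(0,\lambda a.\emptyset)$, $\mathtt{1}=(1,\lambda a.\emptyset)$,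 $(o_1,\delta_1)\oplus(o_2,\delta_2)=(o_1\vee o_2,\lambda a.\delta_1(a)\cup\delta_2(a))$, $(o_1,\delta_1)\otimes(o_2,\delta_2)=(o_1\wedge o_2,\lambda a.(\delta_1(a)(i(o_2)\cup\bigcup_{b\in A}\{b\}\delta_2(b))\cup i(o_1)\delta_2(a)))$; this is an idempotent semiring, and $\mathcal{P}_\omega((X+A)^*)$ (union, concatenation, $\emptyset$, $\{\epsilon\}$) is the free idempotent semiring on $X+A$. $(O,\Delta)$ is the unique semiring homomorphism $\mathcal{P}_\omega((X+A)^*)\to\mathbb{B}\times\mathcal{P}_\omega((X+A)^*)^A$ with $(O,\Delta)(\{x\})=(o(x),\delta(x))$ for $x\in X$ and $(O,\Delta)(\{b\})=(0,\lambda a.i([b=a]))$ for $b\in A$. -}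

module Defs where

open import Data.Bool using (Bool; true; false; _∨_; _∧_)
open import Data.Nat using (ℕ)
open import Data.Fin using (Fin; _≟_)
open import Data.List using (List; []; _∷_; _++_; concatMap; map; allFin)
open import Data.Bool.ListAction using (any)
open import Data.Sum using (_⊎_; inj₁; inj₂)
open import Data.Product using (_×_; _,_; proj₁; proj₂)
open import Data.List.Membership.Propositional using (_∈_)
open import Function.Bundles using (_⇔_)
open import Relation.Binary.PropositionalEquality using (_≡_)
open import Relation.Nullary.Decidable using (⌊_⌋)

module _ (X : Set) (n : ℕ) where

  Letter : Set
  Letter = X ⊎ Fin n

  Word : Set
  Word = List Letter

  -- P_ω((X+A)^*): finite sets of words, represented by lists,
  -- considered up to extensional (same-members) equality _≈_.
  FSet : Set
  FSet = List Word

  _≈_ : FSet → FSet → Set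
  S ≈ T = ∀ w → (w ∈ S) ⇔ (w ∈ T)

  ∅ : FSet
  ∅ = []

  ε : FSet
  ε = [] ∷ []

  _∪_ : FSet → FSet → FSet
  S ∪ T = S ++ T

  _·_ : FSet → FSet → FSet
  S · T = concatMap (λ s → map (λ t → s ++ t) T) S

  i : Bool → FSet
  i true = ε
  i false = ∅

  ⋃A : (Fin n → FSet) → FSet
  ⋃A F = concatMap F (allFin n)

  [_==_] : Fin n → Fin n → Bool
  [ b == a ] = ⌊ b ≟ a ⌋

  T : Set
  T = Bool × (Fin n → FSet)

  _≈T_ : T → T → Set
  (o₁ , δ₁) ≈T (o₂ , δ₂) = (o₁ ≡ o₂) × (∀ a → δ₁ a ≈ δ₂ a)

  𝟘 : T
  𝟘 = false , λ _ → ∅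

  𝟙 : T
  𝟙 = true , λ _ → ∅

  _⊕_ : T → T → T
  (o₁ , δ₁) ⊕ (o₂ , δ₂) = (o₁ ∨ o₂) , λ a → δ₁ a ∪ δ₂ a

  _⊗_ : T → T → T
  (o₁ , δ₁) ⊗ (o₂ , δ₂) =
    (o₁ ∧ o₂) ,
    λ a → (δ₁ a · (i o₂ ∪ ⋃A (λ b → ((inj₂ b ∷ []) ∷ []) · δ₂ b))) ∪ (i o₁ · δ₂ a)

  Coalg : Set
  Coalg = X → T

  module _ (c : Coalg) where

    o : X → Bool
    o x = proj₁ (c x)

    δ : X → Fin n → FSet
    δ x = proj₂ (c x)

    ôw : Word → Bool
    δ̂w : Word → Fin n → FSet
    ôw [] = true
    ôw (inj₁ x ∷ s) = o x ∧ ôw s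
    ôw (inj₂ b ∷ s) = false
    δ̂w [] a = ∅
    δ̂w (inj₁ x ∷ s) a =
      (δ x a · (i (ôw s) ∪ ⋃A (λ b → ((inj₂ b ∷ []) ∷ []) · δ̂w s b))) ∪ (i (o x) · δ̂w s a)
    δ̂w (inj₂ b ∷ s) a =
      i [ b == a ] · (i (ôw s) ∪ ⋃A (λ c → ((inj₂ c ∷ []) ∷ []) · δ̂w s c))

    ô : FSet → Bool
    ô S = any ôw S

    δ̂ : FSet → Fin n → FSet
    δ̂ S a = concatMap (λ s → δ̂w s a) S

    record IsOΔ (h : FSet → T) : Set where
      field
        resp-≈  : ∀ S S′ → S ≈ S′ → h S ≈T h S′
        hom-0   : h ∅ ≈T 𝟘
        hom-1   : h ε ≈T 𝟙
        hom-∪   : ∀ S S′ → h (S ∪ S′) ≈T (h S ⊕ h S′)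
        hom-·   : ∀ S S′ → h (S · S′) ≈T (h S ⊗ h S′)
        gen-X   : ∀ x → h ((inj₁ x ∷ []) ∷ []) ≈T (o x , δ x)
        gen-A   : ∀ b → h ((inj₂ b ∷ []) ∷ []) ≈T (false , λ a → i [ b == a ])

module Submission where

open import Data.Bool using (Bool; false)
open import Data.Fin using (Fin)
open import Data.List using ([]; _∷_; allFin)
open import Data.List.Properties using (++-identityʳ)
open import Data.List.Relation.Binary.BagAndSetEquality
  using (_∼[_]_; set; ++-cong; map-cong; >>=-cong)
open import Data.Nat using (ℕ)
open import Data.Product using (_×_; _,_; proj₁; proj₂)
open import Data.Sum using (inj₁; inj₂)
open import Function.Properties.Equivalence as ⇔ using ()
open import Relation.Binary.Bundles using (Setoid)
open import Relation.Binary.PropositionalEquality as ≡ using (_≡_)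
import Relation.Binary.Reasoning.Setoid as SetoidReasoning
import Defs

-- For a word l s the homomorphism h gives h {l s} = h {l} ⊗ h {s}, and the
-- clauses defining δ̂ on {l s} are literally h {l} ⊗ (ô {s} , δ̂ {s}); so h and
-- (ô , δ̂) agree on singletons by induction on words, and on all finite sets
-- because these are unions of singletons.  The only discrepancy is the summand
-- i(0) · {s}_a that ⊗ contributes for a letter b ∈ A, which is empty.

module FreeSemiringCoalgebra (X : Set) (n : ℕ) where

  Letter : Set
  Letter = Defs.Letter X n

  Word : Set
  Word = Defs.Word X n

  FSet : Set
  FSet = Defs.FSet X n

  T : Set
  T = Defs.T X n

  infix  4 _≈_ _≈T_
  infixl 6 _⊕_ _∪_
  infixl 7 _⊗_ _·_

  _≈_ : FSet → FSet → Set
  _≈_ = Defs._≈_ X n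

  _∪_ : FSet → FSet → FSet
  _∪_ = Defs._∪_ X n

  _·_ : FSet → FSet → FSet
  _·_ = Defs._·_ X n

  i : Bool → FSet
  i = Defs.i X n

  ⋃A : (Fin n → FSet) → FSet
  ⋃A = Defs.⋃A X n

  _≈T_ : T → T → Set
  _≈T_ = Defs._≈T_ X n

  _⊕_ : T → T → T
  _⊕_ = Defs._⊕_ X n

  _⊗_ : T → T → T
  _⊗_ = Defs._⊗_ X n

  [_] : Word → FSet
  [ s ] = s ∷ []

  ∼⇒≈ : ∀ {S S′} → S ∼[ set ] S′ → S ≈ S′
  ∼⇒≈ S∼S′ w = S∼S′ {w}

  ≈⇒∼ : ∀ {S S′} → S ≈ S′ → S ∼[ set ] S′
  ≈⇒∼ S≈S′ {w} = S≈S′ w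

  ≈-refl : ∀ {S} → S ≈ S
  ≈-refl w = ⇔.refl

  ≈-reflexive : ∀ {S S′} → S ≡ S′ → S ≈ S′
  ≈-reflexive ≡.refl = ≈-refl

  ∪-cong : ∀ {S S′ U U′} → S ≈ S′ → U ≈ U′ → S ∪ U ≈ S′ ∪ U′
  ∪-cong S≈S′ U≈U′ = ∼⇒≈ (++-cong (≈⇒∼ S≈S′) (≈⇒∼ U≈U′))

  ·-cong : ∀ {S S′ U U′} → S ≈ S′ → U ≈ U′ → S · U ≈ S′ · U′
  ·-cong S≈S′ U≈U′ = ∼⇒≈ (>>=-cong (≈⇒∼ S≈S′) λ s → map-cong (λ _ → ≡.refl) (≈⇒∼ U≈U′))

  ⋃A-cong : ∀ {F G} → (∀ b → F b ≈ G b) → ⋃A F ≈ ⋃A G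
  ⋃A-cong F≈G = ∼⇒≈ (>>=-cong {xs = allFin n} (λ {b} → ⇔.refl) λ b → ≈⇒∼ (F≈G b))

  ≈T-setoid : Setoid _ _
  ≈T-setoid = record
    { Carrier       = T
    ; _≈_           = _≈T_
    ; isEquivalence = record
      { refl  = ≡.refl , λ a → ≈-refl
      ; sym   = λ (o≡ , δ≈) → ≡.sym o≡ , λ a w → ⇔.sym (δ≈ a w)
      ; trans = λ (o≡ , δ≈) (o≡′ , δ≈′) → ≡.trans o≡ o≡′ , λ a w → ⇔.trans (δ≈ a w) (δ≈′ a w)
      }
    }

  ⊕-cong : ∀ {p p′ q q′} → p ≈T p′ → q ≈T q′ → p ⊕ q ≈T p′ ⊕ q′
  ⊕-cong (≡.refl , δ≈) (≡.refl , δ≈′) = ≡.refl , λ a → ∪-cong (δ≈ a) (δ≈′ a)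

  ⊗-cong : ∀ {p p′ q q′} → p ≈T p′ → q ≈T q′ → p ⊗ q ≈T p′ ⊗ q′
  ⊗-cong {o₁ , _} {_} {o₂ , _} (≡.refl , δ≈) (≡.refl , δ≈′) = ≡.refl , λ a →
    ∪-cong (·-cong (δ≈ a) (∪-cong (≈-refl {i o₂}) (⋃A-cong λ b → ·-cong (≈-refl {[ inj₂ b ∷ [] ]}) (δ≈′ b))))
           (·-cong (≈-refl {i o₁}) (δ≈′ a))

  singleton-∷ : ∀ l s → [ l ∷ s ] ≈ [ l ∷ [] ] · [ s ]
  singleton-∷ l s = ≈-reflexive (≡.sym (++-identityʳ [ l ∷ s ]))

  module _ (c : Defs.Coalg X n) (h : FSet → T) (isOΔ : Defs.IsOΔ X n c h) where

    open Defs.IsOΔ isOΔ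
    open SetoidReasoning ≈T-setoid

    ôw : Word → Bool
    ôw = Defs.ôw X n c

    δ̂w : Word → Fin n → FSet
    δ̂w = Defs.δ̂w X n c

    ô : FSet → Bool
    ô = Defs.ô X n c

    δ̂ : FSet → Fin n → FSet
    δ̂ = Defs.δ̂ X n c

    generator : Letter → T
    generator (inj₁ x) = c x
    generator (inj₂ b) = false , λ a → i (Defs.[_==_] X n b a)

    h-letter : ∀ l → h [ l ∷ [] ] ≈T generator l
    h-letter (inj₁ x) = gen-X x
    h-letter (inj₂ b) = gen-A b

    generator-⊗ : ∀ l s → generator l ⊗ (ôw s , δ̂w s) ≈T (ôw (l ∷ s) , δ̂w (l ∷ s))
    generator-⊗ (inj₁ x) s = ≡.refl , λ a → ≈-refl
    generator-⊗ (inj₂ b) s = ≡.refl , λ a → ≈-reflexive (++-identityʳ (δ̂w (inj₂ b ∷ s) a))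

    h-word : ∀ s → h [ s ] ≈T (ôw s , δ̂w s)
    h-word []      = hom-1
    h-word (l ∷ s) = begin
      h [ l ∷ s ]                    ≈⟨ resp-≈ _ _ (singleton-∷ l s) ⟩
      h ([ l ∷ [] ] · [ s ])         ≈⟨ hom-· _ _ ⟩
      h [ l ∷ [] ] ⊗ h [ s ]         ≈⟨ ⊗-cong (h-letter l) (h-word s) ⟩
      generator l ⊗ (ôw s , δ̂w s)    ≈⟨ generator-⊗ l s ⟩
      (ôw (l ∷ s) , δ̂w (l ∷ s))      ∎

    h-set : ∀ S → h S ≈T (ô S , δ̂ S)
    h-set []      = hom-0
    h-set (s ∷ S) = begin
      h ([ s ] ∪ S)                 ≈⟨ hom-∪ [ s ] S ⟩
      h [ s ] ⊕ h S                 ≈⟨ ⊕-cong (h-word s) (h-set S) ⟩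
      (ôw s , δ̂w s) ⊕ (ô S , δ̂ S)   ∎

open import Defs

proposition7p2 : (X : Set) (n : ℕ) (c : Coalg X n) (h : FSet X n → T X n) →
    IsOΔ X n c h →
    ∀ (S : FSet X n) →
      (proj₁ (h S) ≡ ô X n c S) × (∀ (a : Fin n) → _≈_ X n (proj₂ (h S) a) (δ̂ X n c S a))
proposition7p2 X n c h isOΔ = FreeSemiringCoalgebra.h-set X n c h isOΔ
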